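{- Let $G$ be a graph having an independent set $S=\{s_1,s_2,s_3\}$ such that $G\setminus S$ has exactly two connected components $A$ and $A'$, each a complete graph on an odd number of at least three vertices, and such that there exist $a\in A$, $a'\in A'$ with $N(s_1)=A\cup\{a'\}$, $N(s_2)=A'\cup\{a\}$ and $N(s_3)=(A\cup A')\setminus\{a,a'\}$. Then $G$ is a connected equimatchable claw-free graph with an odd number of vertices and $\alpha(G)=\kappa(G)=3$.
   Context: A graph is equimatchable if all its maximal matchings have the same cardinality; claw-free if it has no induced $K_{1,3}$. $\alpha(G)$ is the independence number and $\kappa(G)$ the vertex connectivity. $N(v)$ is the neighborhood of $v$. -}

module Defs where

open import Data.Nat using (ℕ; suc; _+_; _*_; _≤_; _<_)
open import Data.Fin using (Fin)
open import Data.Fin.Subset using (Subset; _∈_; _∉_; ∣_∣)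
open import Data.Product using (Σ; ∃; ∃-syntax; _×_; _,_; proj₁; proj₂)
open import Data.Sum using (_⊎_)
open import Data.List using (List; []; _∷_; length; concatMap)
open import Data.List.Relation.Unary.Unique.Propositional using (Unique)
open import Data.List.Relation.Unary.All using (All)
open import Data.List.Membership.Propositional using () renaming (_∈_ to _∈ₗ_)
open import Data.Unit using (⊤)
open import Relation.Nullary using (¬_; Dec)
open import Relation.Binary.PropositionalEquality using (_≡_; _≢_)

record Graph (n : ℕ) : Set₁ where
  field
    E      : Fin n → Fin n → Set
    sym    : ∀ {u v} → E u v → E v u
    irrefl : ∀ {u} → ¬ E u u
    dec    : ∀ u v → Dec (E u v)
open Graph public

module _ {n : ℕ} (G : Graph n) where

  data Walk (P : Fin n → Set) : Fin n → Fin n → Set where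
    here : ∀ {u} → P u → Walk P u u
    step : ∀ {u v w} → P u → E G u v → Walk P v w → Walk P u w

  Connected : Set
  Connected = ∀ u v → Walk (λ _ → ⊤) u v

  ConnectedWithout : Subset n → Set
  ConnectedWithout X = ∀ u v → u ∉ X → v ∉ X → Walk (λ w → w ∉ X) u v

  IsComponent : (Fin n → Set) → Subset n → Set
  IsComponent P C =
    (∃[ v ] v ∈ C)
    × (∀ v → v ∈ C → P v)
    × (∀ u v → u ∈ C → v ∈ C → Walk P u v)
    × (∀ u v → u ∈ C → P v → E G u v → v ∈ C)

  Independent : Subset n → Set
  Independent I = ∀ u v → u ∈ I → v ∈ I → ¬ E G u v

  IndependenceNumber : ℕ → Set
  IndependenceNumber k =
    (∃[ I ] (Independent I × ∣ I ∣ ≡ k))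
    × (∀ I → Independent I → ∣ I ∣ ≤ k)

  KConnected : ℕ → Set
  KConnected k = k < n × (∀ X → ∣ X ∣ < k → ConnectedWithout X)

  VertexConnectivity : ℕ → Set
  VertexConnectivity k = KConnected k × ¬ KConnected (suc k)

  endpoints : List (Fin n × Fin n) → List (Fin n)
  endpoints = concatMap (λ e → proj₁ e ∷ proj₂ e ∷ [])

  IsMatching : List (Fin n × Fin n) → Set
  IsMatching M = All (λ e → E G (proj₁ e) (proj₂ e)) M × Unique (endpoints M)

  IsMaximalMatching : List (Fin n × Fin n) → Set
  IsMaximalMatching M =
    IsMatching M × (∀ u v → E G u v → u ∈ₗ endpoints M ⊎ v ∈ₗ endpoints M)

  Equimatchable : Set
  Equimatchable = ∀ M M' → IsMaximalMatching M → IsMaximalMatching M' → length M ≡ length M'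

  ClawFree : Set
  ClawFree = ∀ c x y z → E G c x → E G c y → E G c z →
    x ≢ y → x ≢ z → y ≢ z →
    ¬ (¬ E G x y × ¬ E G x z × ¬ E G y z)

Odd : ℕ → Set
Odd k = ∃[ m ] k ≡ suc (2 * m)

-- V(G) = S ∪ A ∪ A' is covered by the three cliques A ∪ {s₁}, A' ∪ {s₂} and {s₃}, and the only edges
-- between the first two are s₁a' and as₂. An independent set meets each clique at most once, so α = 3 (S
-- attains it), and three pairwise nonadjacent vertices meet all three cliques. A claw centre would thus see
-- s₃, so it lies in A ∖ {a} or A' ∖ {a'}, and then it has no neighbour in A' ∪ {s₂}, resp. in A ∪ {s₁}.
-- Uncovered vertices of a maximal matching are pairwise nonadjacent. If there were three, they would be s₃,
-- some u ∈ A ∪ {s₁} and v ∈ A' ∪ {s₂}; as s₃ is uncovered, u ∈ {s₁, a} and v ∈ {s₂, a'} are nonadjacent, so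
-- no matching edge leaves K₀ = A ∪ {s₁} and the |A| covered vertices of K₀ are matched among themselves,
-- contradicting that |A| is odd. Hence every maximal matching misses exactly one of the odd number
-- n = |A| + |A'| + 3 of vertices. Finally, the A–A' paths through {s₁, a'}, {a, s₂} and {s₃} are internally
-- disjoint, so deleting two vertices leaves G connected, whereas deleting S separates A from A'.

module Submission where

open import Defs hiding (sym)
open import Data.Nat using (ℕ; zero; suc; _+_; _*_; _∸_; _≤_; _<_; z≤n; s≤s)
open import Data.Nat.Properties
  using (≤-total; ≤-trans; <-≤-trans; <⇒≱; ≰⇒>; n<1+n; m≤n+m; +-mono-≤; +-suc; +-comm; +-identityʳ; *-suc;
         suc-injective; *-cancelˡ-≡; m+[n∸m]≡n; even≢odd)
open import Data.Nat.Tactic.RingSolver using (solve-∀)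
open import Data.Fin using (Fin; zero; suc)
open import Data.Fin.Properties using (_≟_; ¬∀⟶∃¬; any?)
open import Data.Fin.Subset using (Subset; _∈_; _∉_; ∣_∣; _⊆_; ⁅_⁆; _∪_; ⊤; ∁; inside; outside) renaming (⊥ to ∅)
open import Data.Fin.Subset.Properties
  using (_∈?_; _⊆?_; ⊆-antisym; p⊆q⇒∣p∣≤∣q∣; p⊂q⇒∣p∣<∣q∣; ∣p∣≤n; ∣⊥∣≡0; ∣⊤∣≡n; ∣p∣≡n⇒p≡⊤; ∣⁅x⁆∣≡1; ∣∁p∣≡n∸∣p∣;
         ∉⊥; ∈⊤; x∈⁅x⁆; x∈⁅y⁆⇒x≡y; x∉⁅y⁆⇒x≢y; x∈p∪q⁻; x∈p∪q⁺; p⊆p∪q; x∈∁p⇒x∉p)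
open import Data.Vec using ([]; _∷_; here; there)
open import Data.List using (List; []; _∷_; length; filter)
open import Data.List.Properties using (filter-accept; filter-reject)
open import Data.List.Relation.Unary.Any using (here; there)
open import Data.List.Relation.Unary.All using (All; []; _∷_)
open import Data.List.Relation.Unary.All.Properties using (All¬⇒¬Any)
open import Data.List.Relation.Unary.AllPairs using (_∷_)
open import Data.List.Relation.Unary.Unique.Propositional using (Unique)
import Data.List.Relation.Unary.Unique.Propositional.Properties as Unique
open import Data.List.Membership.Propositional using () renaming (_∈_ to _∈ₗ_; _∉_ to _∉ₗ_)
open import Data.List.Membership.Propositional.Properties using (∈-filter⁺; ∈-filter⁻)
import Data.List.Membership.DecPropositional as DecMembership
open import Data.Product using (∃-syntax; _×_; _,_; proj₁; proj₂; swap)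
open import Data.Sum using (_⊎_; inj₁; inj₂; [_,_]; [_,_]′)
import Data.Sum
open import Data.Empty using (⊥)
open import Data.Unit using (tt)
open import Function using (_∘_; id)
open import Function.Bundles using (_⇔_; Equivalence)
open import Relation.Nullary using (¬_; Dec; yes; no; does; contradiction)
open import Relation.Nullary.Decidable using (_→-dec_; _×-dec_; ¬?)
open import Relation.Unary using (Decidable)
open import Relation.Binary.PropositionalEquality
  using (_≡_; _≢_; refl; sym; ≢-sym; trans; cong; cong₂; subst; module ≡-Reasoning)

fromDec : ∀ {n} {P : Fin n → Set} → Decidable P → Subset n
fromDec {zero}  P? = []
fromDec {suc n} P? = does (P? zero) ∷ fromDec (P? ∘ suc)

∈-fromDec⁺ : ∀ {n} {P : Fin n → Set} (P? : Decidable P) → ∀ {x} → P x → x ∈ fromDec P?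
∈-fromDec⁺ {suc _} P? {zero} Px with P? zero
... | yes _ = here
... | no ¬Px = contradiction Px ¬Px
∈-fromDec⁺ {suc _} P? {suc x} Px = there (∈-fromDec⁺ (P? ∘ suc) Px)

∈-fromDec⁻ : ∀ {n} {P : Fin n → Set} (P? : Decidable P) → ∀ {x} → x ∈ fromDec P? → P x
∈-fromDec⁻ {suc _} P? {zero} x∈ with P? zero
... | yes Px = Px
∈-fromDec⁻ {suc _} P? {zero} () | no _
∈-fromDec⁻ {suc _} P? {suc x} (there x∈) = ∈-fromDec⁻ (P? ∘ suc) x∈

∣p∪q∣≡∣p∣+∣q∣ : ∀ {n} {p q : Subset n} → (∀ {x} → x ∈ p → x ∉ q) → ∣ p ∪ q ∣ ≡ ∣ p ∣ + ∣ q ∣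
∣p∪q∣≡∣p∣+∣q∣ {_} {[]}          {[]}          _    = refl
∣p∪q∣≡∣p∣+∣q∣ {_} {outside ∷ p} {outside ∷ q} disj = ∣p∪q∣≡∣p∣+∣q∣ (λ x∈p x∈q → disj (there x∈p) (there x∈q))
∣p∪q∣≡∣p∣+∣q∣ {_} {outside ∷ p} {inside ∷ q}  disj =
  trans (cong suc (∣p∪q∣≡∣p∣+∣q∣ (λ x∈p x∈q → disj (there x∈p) (there x∈q)))) (sym (+-suc ∣ p ∣ ∣ q ∣))
∣p∪q∣≡∣p∣+∣q∣ {_} {inside ∷ p}  {outside ∷ q} disj = cong suc (∣p∪q∣≡∣p∣+∣q∣ (λ x∈p x∈q → disj (there x∈p) (there x∈q)))
∣p∪q∣≡∣p∣+∣q∣ {_} {inside ∷ p}  {inside ∷ q}  disj = contradiction here (disj here)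

p⊈q⇒∃∈p∖q : ∀ {n} {p q : Subset n} → ¬ (p ⊆ q) → ∃[ x ] x ∈ p × x ∉ q
p⊈q⇒∃∈p∖q {n} {p} {q} p⊈q with ¬∀⟶∃¬ n (λ x → x ∈ p → x ∈ q) (λ x → x ∈? p →-dec x ∈? q) (λ f → p⊈q (f _))
... | x , ¬[x∈p⇒x∈q] with x ∈? p | x ∈? q
...   | yes x∈p | no x∉q  = x , x∈p , x∉q
...   | yes _   | yes x∈q = contradiction (λ _ → x∈q) ¬[x∈p⇒x∈q]
...   | no x∉p  | _       = contradiction (λ x∈p → contradiction x∈p x∉p) ¬[x∈p⇒x∈q]

∣q∣<∣p∣⇒∃∈p∖q : ∀ {n} {p q : Subset n} → ∣ q ∣ < ∣ p ∣ → ∃[ x ] x ∈ p × x ∉ q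
∣q∣<∣p∣⇒∃∈p∖q ∣q∣<∣p∣ = p⊈q⇒∃∈p∖q (λ p⊆q → <⇒≱ ∣q∣<∣p∣ (p⊆q⇒∣p∣≤∣q∣ p⊆q))

∣⁅x⁆∪p∣≡1+∣p∣ : ∀ {n} {x : Fin n} {p : Subset n} → x ∉ p → ∣ ⁅ x ⁆ ∪ p ∣ ≡ suc ∣ p ∣
∣⁅x⁆∪p∣≡1+∣p∣ {_} {x} {p} x∉p =
  trans (∣p∪q∣≡∣p∣+∣q∣ (λ w∈x → x∉p ∘ subst (_∈ p) (x∈⁅y⁆⇒x≡y x w∈x))) (cong (_+ ∣ p ∣) (∣⁅x⁆∣≡1 x))

triple : ∀ {n} → Fin n → Fin n → Fin n → Subset n
triple x y z = ⁅ x ⁆ ∪ (⁅ y ⁆ ∪ ⁅ z ⁆)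

∈-triple⁺ : ∀ {n} {w x y z : Fin n} → w ≡ x ⊎ w ≡ y ⊎ w ≡ z → w ∈ triple x y z
∈-triple⁺ (inj₁ refl)        = x∈p∪q⁺ (inj₁ (x∈⁅x⁆ _))
∈-triple⁺ (inj₂ (inj₁ refl)) = x∈p∪q⁺ (inj₂ (x∈p∪q⁺ (inj₁ (x∈⁅x⁆ _))))
∈-triple⁺ (inj₂ (inj₂ refl)) = x∈p∪q⁺ (inj₂ (x∈p∪q⁺ (inj₂ (x∈⁅x⁆ _))))

∈-pair⁻ : ∀ {n} {w : Fin n} x y → w ∈ ⁅ x ⁆ ∪ ⁅ y ⁆ → w ≡ x ⊎ w ≡ y
∈-pair⁻ x y w∈ = Data.Sum.map (x∈⁅y⁆⇒x≡y x) (x∈⁅y⁆⇒x≡y y) (x∈p∪q⁻ ⁅ x ⁆ ⁅ y ⁆ w∈)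

∈-triple⁻ : ∀ {n} {w : Fin n} x y z → w ∈ triple x y z → w ≡ x ⊎ w ≡ y ⊎ w ≡ z
∈-triple⁻ x y z w∈ = Data.Sum.map (x∈⁅y⁆⇒x≡y x) (∈-pair⁻ y z) (x∈p∪q⁻ ⁅ x ⁆ _ w∈)

∉-pair⁻ : ∀ {n} {w x y : Fin n} → w ∉ ⁅ x ⁆ ∪ ⁅ y ⁆ → w ≢ x × w ≢ y
∉-pair⁻ w∉ = (λ { refl → w∉ (x∈p∪q⁺ (inj₁ (x∈⁅x⁆ _))) }) , (λ { refl → w∉ (x∈p∪q⁺ (inj₂ (x∈⁅x⁆ _))) })

∉-triple⁻ : ∀ {n} {w x y z : Fin n} → w ∉ triple x y z → w ≢ x × w ≢ y × w ≢ z
∉-triple⁻ w∉ = (λ { refl → w∉ (∈-triple⁺ (inj₁ refl)) }) ,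
               (λ { refl → w∉ (∈-triple⁺ (inj₂ (inj₁ refl))) }) ,
               (λ { refl → w∉ (∈-triple⁺ (inj₂ (inj₂ refl))) })

∣pair∣≡2 : ∀ {n} {x y : Fin n} → x ≢ y → ∣ ⁅ x ⁆ ∪ ⁅ y ⁆ ∣ ≡ 2
∣pair∣≡2 {_} {x} {y} x≢y = trans (∣⁅x⁆∪p∣≡1+∣p∣ (x≢y ∘ x∈⁅y⁆⇒x≡y y)) (cong suc (∣⁅x⁆∣≡1 y))

∣triple∣≡3 : ∀ {n} {x y z : Fin n} → x ≢ y → x ≢ z → y ≢ z → ∣ triple x y z ∣ ≡ 3
∣triple∣≡3 {_} {x} {y} {z} x≢y x≢z y≢z = trans (∣⁅x⁆∪p∣≡1+∣p∣ x∉yz) (cong suc (∣pair∣≡2 y≢z))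
  where
  x∉yz : x ∉ ⁅ y ⁆ ∪ ⁅ z ⁆
  x∉yz x∈ = [ x≢y , x≢z ] (∈-pair⁻ y z x∈)

three-distinct⇒3≤∣p∣ : ∀ {n} {p : Subset n} {x y z} → x ∈ p → y ∈ p → z ∈ p → x ≢ y → x ≢ z → y ≢ z → 3 ≤ ∣ p ∣
three-distinct⇒3≤∣p∣ {_} {p} {x} {y} {z} x∈p y∈p z∈p x≢y x≢z y≢z =
  subst (_≤ ∣ p ∣) (∣triple∣≡3 x≢y x≢z y≢z) (p⊆q⇒∣p∣≤∣q∣ triple⊆p)
  where
  triple⊆p : triple x y z ⊆ p
  triple⊆p w∈ with ∈-triple⁻ x y z w∈
  ... | inj₁ refl        = x∈p
  ... | inj₂ (inj₁ refl) = y∈p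
  ... | inj₂ (inj₂ refl) = z∈p

∣p∣<3⇒third∉p : ∀ {n} {p : Subset n} {x y z} → ∣ p ∣ < 3 → x ∈ p → y ∈ p → x ≢ y → z ≢ x → z ≢ y → z ∉ p
∣p∣<3⇒third∉p ∣p∣<3 x∈p y∈p x≢y z≢x z≢y z∈p =
  <⇒≱ ∣p∣<3 (three-distinct⇒3≤∣p∣ x∈p y∈p z∈p x≢y (z≢x ∘ sym) (z≢y ∘ sym))

two-others : ∀ {n} {p : Subset n} → 3 ≤ ∣ p ∣ → ∀ v → ∃[ x ] ∃[ y ] x ∈ p × y ∈ p × x ≢ y × x ≢ v × y ≢ v
two-others {p = p} 3≤∣p∣ v
  with x , x∈p , x∉v ← ∣q∣<∣p∣⇒∃∈p∖q {p = p} {⁅ v ⁆} (subst (_< ∣ p ∣) (sym (∣⁅x⁆∣≡1 v)) (<-≤-trans (s≤s (s≤s z≤n)) 3≤∣p∣))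
  with y , y∈p , y∉vx ← ∣q∣<∣p∣⇒∃∈p∖q {p = p} {⁅ v ⁆ ∪ ⁅ x ⁆} (subst (_< ∣ p ∣) (sym (∣pair∣≡2 (≢-sym (x∉⁅y⁆⇒x≢y x∉v)))) 3≤∣p∣)
  = x , y , x∈p , y∈p , ≢-sym (proj₂ (∉-pair⁻ y∉vx)) , x∉⁅y⁆⇒x≢y x∉v , proj₁ (∉-pair⁻ y∉vx)

3≤∣p∣⇒three-distinct : ∀ {n} {p : Subset n} → 3 ≤ ∣ p ∣ →
  ∃[ x ] ∃[ y ] ∃[ z ] x ∈ p × y ∈ p × z ∈ p × x ≢ y × x ≢ z × y ≢ z
3≤∣p∣⇒three-distinct {n} {p} 3≤∣p∣
  with x , x∈p , _ ← ∣q∣<∣p∣⇒∃∈p∖q {p = p} {∅} (subst (_< ∣ p ∣) (sym (∣⊥∣≡0 n)) (<-≤-trans (s≤s z≤n) 3≤∣p∣))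
  with y , z , y∈p , z∈p , y≢z , y≢x , z≢x ← two-others 3≤∣p∣ x
  = x , y , z , x∈p , y∈p , z∈p , ≢-sym y≢x , ≢-sym z≢x , y≢z

distinct-triple-covers-Fin3 : (t i j k : Fin 3) → i ≢ j → i ≢ k → j ≢ k → t ≡ i ⊎ t ≡ j ⊎ t ≡ k
distinct-triple-covers-Fin3 t i j k i≢j i≢k j≢k = ∈-triple⁻ i j k (subst (t ∈_) (sym (∣p∣≡n⇒p≡⊤ (∣triple∣≡3 i≢j i≢k j≢k))) ∈⊤)

chain-stabilises : ∀ {n} (f : ℕ → Subset n) → (∀ k → f k ⊆ f (suc k)) → ∃[ k ] f (suc k) ⊆ f k
chain-stabilises {n} f f⊆f∘suc =
  [ id , (λ n<∣f∣ → contradiction (∣p∣≤n (f (suc n))) (<⇒≱ n<∣f∣)) ]′ (stops-or-grows (suc n))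
  where
  stops-or-grows : ∀ k → (∃[ j ] f (suc j) ⊆ f j) ⊎ k ≤ ∣ f k ∣
  stops-or-grows zero = inj₂ z≤n
  stops-or-grows (suc k) with stops-or-grows k | f (suc k) ⊆? f k
  ... | inj₁ stops | _        = inj₁ stops
  ... | inj₂ _     | yes stop = inj₁ (k , stop)
  ... | inj₂ k≤∣f∣ | no grows = inj₂ (≤-trans (s≤s k≤∣f∣) (p⊂q⇒∣p∣<∣q∣ (f⊆f∘suc k , p⊈q⇒∃∈p∖q grows)))

_∈ₗ?_ : ∀ {n} (x : Fin n) (L : List (Fin n)) → Dec (x ∈ₗ L)
_∈ₗ?_ = DecMembership._∈?_ _≟_

fromList : ∀ {n} → List (Fin n) → Subset n
fromList L = fromDec (_∈ₗ? L)

∣fromList∣≡length : ∀ {n} {L : List (Fin n)} → Unique L → ∣ fromList L ∣ ≡ length L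
∣fromList∣≡length {n} {[]} _ = trans (cong ∣_∣ fromList[]≡∅) (∣⊥∣≡0 n)
  where
  fromList[]≡∅ : fromList {n} [] ≡ ∅
  fromList[]≡∅ = ⊆-antisym (λ x∈ → contradiction (∈-fromDec⁻ (_∈ₗ? []) x∈) λ ()) (λ x∈⊥ → contradiction x∈⊥ ∉⊥)
∣fromList∣≡length {L = x ∷ L} (x∉L ∷ unique) = begin
    ∣ fromList (x ∷ L) ∣      ≡⟨ cong ∣_∣ fromList-∷ ⟩
    ∣ ⁅ x ⁆ ∪ fromList L ∣    ≡⟨ ∣⁅x⁆∪p∣≡1+∣p∣ (All¬⇒¬Any x∉L ∘ ∈-fromDec⁻ (_∈ₗ? L)) ⟩
    suc ∣ fromList L ∣        ≡⟨ cong suc (∣fromList∣≡length unique) ⟩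
    suc (length L)            ∎
  where
  open ≡-Reasoning
  fromList-∷ : fromList (x ∷ L) ≡ ⁅ x ⁆ ∪ fromList L
  fromList-∷ = ⊆-antisym
    (λ y∈ → x∈p∪q⁺ (Data.Sum.map (λ { refl → x∈⁅x⁆ x }) (∈-fromDec⁺ (_∈ₗ? L)) (∈-∷⁻ (∈-fromDec⁻ (_∈ₗ? (x ∷ L)) y∈))))
    (λ y∈ → ∈-fromDec⁺ (_∈ₗ? (x ∷ L)) ([ here ∘ x∈⁅y⁆⇒x≡y x , there ∘ ∈-fromDec⁻ (_∈ₗ? L) ] (x∈p∪q⁻ ⁅ x ⁆ _ y∈)))
    where
    ∈-∷⁻ : ∀ {y} → y ∈ₗ x ∷ L → y ≡ x ⊎ y ∈ₗ L
    ∈-∷⁻ (here y≡x) = inj₁ y≡x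
    ∈-∷⁻ (there y∈L) = inj₂ y∈L

Even : ℕ → Set
Even k = ∃[ m ] k ≡ 2 * m

even⇒¬odd : ∀ {x} → Even x → ¬ Odd x
even⇒¬odd (m , refl) (k , 2m≡1+2k) = even≢odd m k 2m≡1+2k

odd[2m+u]⇒u≡1 : ∀ m {u} → u < 3 → Odd (2 * m + u) → u ≡ 1
odd[2m+u]⇒u≡1 m {0} _ odd = contradiction odd (even⇒¬odd (m , +-identityʳ (2 * m)))
odd[2m+u]⇒u≡1 m {1} _ _   = refl
odd[2m+u]⇒u≡1 m {2} _ odd = contradiction odd (even⇒¬odd (suc m , trans (+-comm (2 * m) 2) (sym (*-suc 2 m))))
odd[2m+u]⇒u≡1 m {suc (suc (suc _))} (s≤s (s≤s (s≤s ()))) _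

odd+odd+odd : ∀ {x y z} → Odd x → Odd y → Odd z → Odd (x + (y + z))
odd+odd+odd (p , refl) (q , refl) (r , refl) = p + q + r + 1 , arith p q r
  where
  arith : ∀ p q r → suc (2 * p) + (suc (2 * q) + suc (2 * r)) ≡ suc (2 * (p + q + r + 1))
  arith = solve-∀

module _ {n} {G : Graph n} {P : Fin n → Set} where

  P-source : ∀ {u v} → Walk G P u v → P u
  P-source (here Pu)     = Pu
  P-source (step Pu _ _) = Pu

  P-target : ∀ {u v} → Walk G P u v → P v
  P-target (here Pv)    = Pv
  P-target (step _ _ w) = P-target w

  _++ʷ_ : ∀ {u v w} → Walk G P u v → Walk G P v w → Walk G P u w
  here _      ++ʷ w' = w'
  step Pu e w ++ʷ w' = step Pu e (w ++ʷ w')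

  edgeʷ : ∀ {u v} → P u → P v → E G u v → Walk G P u v
  edgeʷ Pu Pv e = step Pu e (here Pv)

  reverseʷ : ∀ {u v} → Walk G P u v → Walk G P v u
  reverseʷ (here Pu)     = here Pu
  reverseʷ (step Pu e w) = reverseʷ w ++ʷ edgeʷ (P-source w) Pu (Graph.sym G e)

  walk-stays-in : ∀ (C : Subset n) → (∀ u v → u ∈ C → P v → E G u v → v ∈ C) →
    ∀ {u v} → Walk G P u v → u ∈ C → v ∈ C
  walk-stays-in C closed (here _)     u∈C = u∈C
  walk-stays-in C closed (step _ e w) u∈C = walk-stays-in C closed w (closed _ _ u∈C (P-source w) e)

mapʷ : ∀ {n} {G : Graph n} {P Q : Fin n → Set} → (∀ {v} → P v → Q v) → ∀ {u v} → Walk G P u v → Walk G Q u v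
mapʷ f (here Pu)     = here (f Pu)
mapʷ f (step Pu e w) = step (f Pu) e (mapʷ f w)

module _ {n} (G : Graph n) {P : Fin n → Set} (P? : Decidable P) where

  ball : Fin n → ℕ → Subset n
  ball v zero    = ⁅ v ⁆
  ball v (suc k) = ball v k ∪ fromDec (λ w → P? w ×-dec any? (λ u → u ∈? ball v k ×-dec dec G u w))

  ball-walk : ∀ {v w} k → P v → w ∈ ball v k → Walk G P v w
  ball-walk {v} zero Pv w∈ with x∈⁅y⁆⇒x≡y v w∈
  ... | refl = here Pv
  ball-walk (suc k) Pv w∈ with x∈p∪q⁻ (ball _ k) _ w∈
  ... | inj₁ w∈ball = ball-walk k Pv w∈ball
  ... | inj₂ w∈new with ∈-fromDec⁻ _ w∈new
  ...   | Pw , u , u∈ball , e = ball-walk k Pv u∈ball ++ʷ edgeʷ (P-target (ball-walk k Pv u∈ball)) Pw e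

  v∈ball : ∀ v k → v ∈ ball v k
  v∈ball v zero    = x∈⁅x⁆ v
  v∈ball v (suc k) = p⊆p∪q _ (v∈ball v k)

  component-of : ∀ {v} → P v → ∃[ C ] IsComponent G P C × v ∈ C
  component-of {v} Pv with k , stable ← chain-stabilises (ball v) (λ k → p⊆p∪q _) =
    ball v k ,
    ((v , v∈ball v k) ,
     (λ w w∈ → P-target (ball-walk k Pv w∈)) ,
     (λ x y x∈ y∈ → reverseʷ (ball-walk k Pv x∈) ++ʷ ball-walk k Pv y∈) ,
     (λ x y x∈ Py e → stable (x∈p∪q⁺ (inj₂ (∈-fromDec⁺ _ (Py , x , x∈ , e)))))) ,
    v∈ball v k

module _ {n} {G : Graph n} {P : Fin n → Set} {C : Subset n} (C-comp : IsComponent G P C) where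

  component-⊆ : ∀ {v} → v ∈ C → P v
  component-⊆ = proj₁ (proj₂ C-comp) _

  component-walk : ∀ {u v} → u ∈ C → v ∈ C → Walk G P u v
  component-walk = proj₁ (proj₂ (proj₂ C-comp)) _ _

  component-closed : ∀ u v → u ∈ C → P v → E G u v → v ∈ C
  component-closed = proj₂ (proj₂ (proj₂ C-comp))

components-meet⇒≡ : ∀ {n} {G : Graph n} {P : Fin n → Set} {C D : Subset n} → IsComponent G P C → IsComponent G P D →
  ∀ {x} → x ∈ C → x ∈ D → C ≡ D
components-meet⇒≡ C-comp D-comp x∈C x∈D =
  ⊆-antisym (λ y∈C → walk-stays-in _ (component-closed D-comp) (component-walk C-comp x∈C y∈C) x∈D)
            (λ y∈D → walk-stays-in _ (component-closed C-comp) (component-walk D-comp x∈D y∈D) x∈C)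

IsClique : ∀ {n} → Graph n → Subset n → Set
IsClique G B = ∀ u v → u ∈ B → v ∈ B → u ≢ v → E G u v

clique-walk : ∀ {n} {G : Graph n} {P : Fin n → Set} {B} → IsClique G B → ∀ {x y} → x ∈ B → y ∈ B → P x → P y → Walk G P x y
clique-walk clique {x} {y} x∈B y∈B Px Py with x ≟ y
... | yes refl = here Px
... | no x≢y   = edgeʷ Px Py (clique x y x∈B y∈B x≢y)

module _ {n} (G : Graph n) where

  length-endpoints : ∀ M → length (endpoints G M) ≡ 2 * length M
  length-endpoints []      = refl
  length-endpoints (_ ∷ M) = trans (cong (λ k → suc (suc k)) (length-endpoints M)) (sym (*-suc 2 (length M)))

  maximal⇒uncovered-nonadjacent : ∀ {M x y} → IsMaximalMatching G M →
    x ∉ₗ endpoints G M → y ∉ₗ endpoints G M → ¬ E G x y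
  maximal⇒uncovered-nonadjacent (_ , maximal) x∉ y∉ e = [ x∉ , y∉ ] (maximal _ _ e)

  maximal⇒covered : ∀ {M u w} → IsMaximalMatching G M → u ∉ₗ endpoints G M → E G w u → w ∈ₗ endpoints G M
  maximal⇒covered {M} {u} {w} maxM u∉ e with w ∈ₗ? endpoints G M
  ... | yes w∈ = w∈
  ... | no w∉  = contradiction e (maximal⇒uncovered-nonadjacent maxM w∉ u∉)

  coveredIn : Subset n → List (Fin n × Fin n) → Subset n
  coveredIn K M = fromList (filter (_∈? K) (endpoints G M))

  ∈-coveredIn⁺ : ∀ K M {x} → x ∈ K → x ∈ₗ endpoints G M → x ∈ coveredIn K M
  ∈-coveredIn⁺ K M x∈K x∈M = ∈-fromDec⁺ _ (∈-filter⁺ (_∈? _) x∈M x∈K)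

  ∈-coveredIn⁻ : ∀ K M {x} → x ∈ coveredIn K M → x ∈ K × x ∈ₗ endpoints G M
  ∈-coveredIn⁻ K M x∈ = swap (∈-filter⁻ (_∈? _) (∈-fromDec⁻ _ x∈))

  ClosedAmongCovered : Subset n → List (Fin n × Fin n) → Set
  ClosedAmongCovered K M = ∀ {x y} → x ∈ₗ endpoints G M → y ∈ₗ endpoints G M → E G x y → x ∈ K → y ∈ K

  even-filter-endpoints : ∀ K M → All (λ e → E G (proj₁ e) (proj₂ e)) M → ClosedAmongCovered K M →
    Even (length (filter (_∈? K) (endpoints G M)))
  even-filter-endpoints K [] _ _ = 0 , refl
  even-filter-endpoints K ((x , y) ∷ M) (exy ∷ edges) closed =
    even-filter-∷∷ (x ∈? K)
      (closed (here refl) (there (here refl)) exy)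
      (closed (there (here refl)) (here refl) (Graph.sym G exy))
      (even-filter-endpoints K M edges (λ x∈ y∈ → closed (there (there x∈)) (there (there y∈))))
    where
    even-filter-∷∷ : ∀ {x y xs} → Dec (x ∈ K) → (x ∈ K → y ∈ K) → (y ∈ K → x ∈ K) →
      Even (length (filter (_∈? K) xs)) → Even (length (filter (_∈? K) (x ∷ y ∷ xs)))
    even-filter-∷∷ {x} {y} {xs} (yes x∈K) x⇒y _ (m , ≡2m) = suc m , (begin
      length (filter (_∈? K) (x ∷ y ∷ xs))  ≡⟨ cong length (filter-accept (_∈? K) {xs = y ∷ xs} x∈K) ⟩
      suc (length (filter (_∈? K) (y ∷ xs))) ≡⟨ cong (suc ∘ length) (filter-accept (_∈? K) {xs = xs} (x⇒y x∈K)) ⟩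
      suc (suc (length (filter (_∈? K) xs))) ≡⟨ cong (λ k → suc (suc k)) ≡2m ⟩
      suc (suc (2 * m))                      ≡⟨ sym (*-suc 2 m) ⟩
      2 * suc m                              ∎)
      where open ≡-Reasoning
    even-filter-∷∷ {y = y} {xs} (no x∉K) _ y⇒x (m , ≡2m) =
      m , trans (cong length (trans (filter-reject (_∈? K) {xs = y ∷ xs} x∉K) (filter-reject (_∈? K) {xs = xs} (x∉K ∘ y⇒x)))) ≡2m

  even-coveredIn : ∀ K M → IsMatching G M → ClosedAmongCovered K M → Even ∣ coveredIn K M ∣
  even-coveredIn K M (edges , unique) closed with m , ≡2m ← even-filter-endpoints K M edges closed =
    m , trans (∣fromList∣≡length (Unique.filter⁺ (_∈? K) unique)) ≡2m

module Proposition2Graph {n : ℕ} (G : Graph n) (s₁ s₂ s₃ : Fin n) (A A' : Subset n) (a a' : Fin n)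
  (s₁≢s₂ : s₁ ≢ s₂) (s₁≢s₃ : s₁ ≢ s₃) (s₂≢s₃ : s₂ ≢ s₃)
  (s₁≁s₂ : ¬ E G s₁ s₂) (s₁≁s₃ : ¬ E G s₁ s₃) (s₂≁s₃ : ¬ E G s₂ s₃)
  (A-comp : IsComponent G (λ v → v ≢ s₁ × v ≢ s₂ × v ≢ s₃) A)
  (A'-comp : IsComponent G (λ v → v ≢ s₁ × v ≢ s₂ × v ≢ s₃) A')
  (A≢A' : A ≢ A')
  (only-components : ∀ C → IsComponent G (λ v → v ≢ s₁ × v ≢ s₂ × v ≢ s₃) C → C ≡ A ⊎ C ≡ A')
  (A-clique : IsClique G A) (3≤∣A∣ : 3 ≤ ∣ A ∣) (∣A∣-odd : Odd ∣ A ∣)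
  (A'-clique : IsClique G A') (3≤∣A'∣ : 3 ≤ ∣ A' ∣) (∣A'∣-odd : Odd ∣ A' ∣)
  (a∈A : a ∈ A) (a'∈A' : a' ∈ A')
  (N[s₁] : ∀ v → E G s₁ v ⇔ (v ∈ A ⊎ v ≡ a'))
  (N[s₂] : ∀ v → E G s₂ v ⇔ (v ∈ A' ⊎ v ≡ a))
  (N[s₃] : ∀ v → E G s₃ v ⇔ ((v ∈ A ⊎ v ∈ A') × v ≢ a × v ≢ a'))
  where

  open Equivalence

  Outside : Fin n → Set
  Outside v = v ≢ s₁ × v ≢ s₂ × v ≢ s₃

  A-outside : ∀ {x} → x ∈ A → Outside x
  A-outside = component-⊆ A-comp

  A'-outside : ∀ {x} → x ∈ A' → Outside x
  A'-outside = component-⊆ A'-comp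

  A-disjoint-A' : ∀ {x} → x ∈ A → x ∉ A'
  A-disjoint-A' x∈A x∈A' = A≢A' (components-meet⇒≡ A-comp A'-comp x∈A x∈A')

  A-A'-distinct : ∀ {x y} → x ∈ A → y ∈ A' → x ≢ y
  A-A'-distinct x∈A y∈A' refl = A-disjoint-A' x∈A y∈A'

  s₁∼A : ∀ {x} → x ∈ A → E G s₁ x
  s₁∼A x∈A = from (N[s₁] _) (inj₁ x∈A)

  s₂∼A' : ∀ {x} → x ∈ A' → E G s₂ x
  s₂∼A' x∈A' = from (N[s₂] _) (inj₁ x∈A')

  s₁∼a' : E G s₁ a'
  s₁∼a' = from (N[s₁] _) (inj₂ refl)

  s₂∼a : E G s₂ a
  s₂∼a = from (N[s₂] _) (inj₂ refl)

  s₃∼A∖a : ∀ {x} → x ∈ A → x ≢ a → E G s₃ x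
  s₃∼A∖a x∈A x≢a = from (N[s₃] _) (inj₁ x∈A , x≢a , A-A'-distinct x∈A a'∈A')

  s₃∼A'∖a' : ∀ {x} → x ∈ A' → x ≢ a' → E G s₃ x
  s₃∼A'∖a' x∈A' x≢a' = from (N[s₃] _) (inj₂ x∈A' , A-A'-distinct a∈A x∈A' ∘ sym , x≢a')

  data Location : Fin n → Set where
    at-s₁ : Location s₁
    at-s₂ : Location s₂
    at-s₃ : Location s₃
    in-A  : ∀ {v} → v ∈ A → Location v
    in-A' : ∀ {v} → v ∈ A' → Location v

  locate : ∀ v → Location v
  locate v with v ≟ s₁ | v ≟ s₂ | v ≟ s₃
  ... | yes refl | _        | _        = at-s₁
  ... | no _     | yes refl | _        = at-s₂
  ... | no _     | no _     | yes refl = at-s₃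
  ... | no v≢s₁  | no v≢s₂  | no v≢s₃
    with C , C-comp , v∈C ← component-of G (λ w → ¬? (w ≟ s₁) ×-dec ¬? (w ≟ s₂) ×-dec ¬? (w ≟ s₃)) (v≢s₁ , v≢s₂ , v≢s₃)
    with only-components C C-comp
  ...   | inj₁ refl = in-A v∈C
  ...   | inj₂ refl = in-A' v∈C

  S : Subset n
  S = triple s₁ s₂ s₃

  ∣S∣≡3 : ∣ S ∣ ≡ 3
  ∣S∣≡3 = ∣triple∣≡3 s₁≢s₂ s₁≢s₃ s₂≢s₃

  S-independent : Independent G S
  S-independent u v u∈S v∈S with ∈-triple⁻ s₁ s₂ s₃ u∈S | ∈-triple⁻ s₁ s₂ s₃ v∈S
  ... | inj₁ refl        | inj₁ refl        = irrefl G
  ... | inj₁ refl        | inj₂ (inj₁ refl) = s₁≁s₂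
  ... | inj₁ refl        | inj₂ (inj₂ refl) = s₁≁s₃
  ... | inj₂ (inj₁ refl) | inj₁ refl        = s₁≁s₂ ∘ Graph.sym G
  ... | inj₂ (inj₁ refl) | inj₂ (inj₁ refl) = irrefl G
  ... | inj₂ (inj₁ refl) | inj₂ (inj₂ refl) = s₂≁s₃
  ... | inj₂ (inj₂ refl) | inj₁ refl        = s₁≁s₃ ∘ Graph.sym G
  ... | inj₂ (inj₂ refl) | inj₂ (inj₁ refl) = s₂≁s₃ ∘ Graph.sym G
  ... | inj₂ (inj₂ refl) | inj₂ (inj₂ refl) = irrefl G

  ∉S⇒outside : ∀ {v} → v ∉ S → Outside v
  ∉S⇒outside = ∉-triple⁻

  outside⇒∉S : ∀ {v} → Outside v → v ∉ S
  outside⇒∉S (v≢s₁ , v≢s₂ , v≢s₃) v∈S = [ v≢s₁ , [ v≢s₂ , v≢s₃ ] ] (∈-triple⁻ s₁ s₂ s₃ v∈S)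

  n≡∣A∣+∣A'∣+3 : n ≡ ∣ A ∣ + (∣ A' ∣ + 3)
  n≡∣A∣+∣A'∣+3 = begin
    n                           ≡⟨ sym (∣⊤∣≡n n) ⟩
    ∣ ⊤ {n} ∣                   ≡⟨ cong ∣_∣ ⊤≡A∪A'∪S ⟩
    ∣ A ∪ (A' ∪ S) ∣            ≡⟨ ∣p∪q∣≡∣p∣+∣q∣ A-disjoint-A'∪S ⟩
    ∣ A ∣ + ∣ A' ∪ S ∣          ≡⟨ cong (∣ A ∣ +_) (∣p∪q∣≡∣p∣+∣q∣ (outside⇒∉S ∘ A'-outside)) ⟩
    ∣ A ∣ + (∣ A' ∣ + ∣ S ∣)    ≡⟨ cong (λ k → ∣ A ∣ + (∣ A' ∣ + k)) ∣S∣≡3 ⟩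
    ∣ A ∣ + (∣ A' ∣ + 3)        ∎
    where
    open ≡-Reasoning
    A-disjoint-A'∪S : ∀ {x} → x ∈ A → x ∉ A' ∪ S
    A-disjoint-A'∪S x∈A x∈A'∪S = [ A-disjoint-A' x∈A , outside⇒∉S (A-outside x∈A) ] (x∈p∪q⁻ A' S x∈A'∪S)
    ∈A∪A'∪S : ∀ {v} → Location v → v ∈ A ∪ (A' ∪ S)
    ∈A∪A'∪S at-s₁          = x∈p∪q⁺ (inj₂ (x∈p∪q⁺ (inj₂ (∈-triple⁺ (inj₁ refl)))))
    ∈A∪A'∪S at-s₂          = x∈p∪q⁺ (inj₂ (x∈p∪q⁺ (inj₂ (∈-triple⁺ (inj₂ (inj₁ refl))))))
    ∈A∪A'∪S at-s₃          = x∈p∪q⁺ (inj₂ (x∈p∪q⁺ (inj₂ (∈-triple⁺ (inj₂ (inj₂ refl))))))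
    ∈A∪A'∪S (in-A v∈A)     = x∈p∪q⁺ (inj₁ v∈A)
    ∈A∪A'∪S (in-A' v∈A')   = x∈p∪q⁺ (inj₂ (x∈p∪q⁺ (inj₁ v∈A')))
    ⊤≡A∪A'∪S : ⊤ {n} ≡ A ∪ (A' ∪ S)
    ⊤≡A∪A'∪S = ⊆-antisym (λ {v} _ → ∈A∪A'∪S (locate v)) (λ _ → ∈⊤)

  Class : Fin 3 → Fin n → Set
  Class zero             v = v ∈ A ⊎ v ≡ s₁
  Class (suc zero)       v = v ∈ A' ⊎ v ≡ s₂
  Class (suc (suc zero)) v = v ≡ s₃

  class-of : ∀ v → ∃[ t ] Class t v
  class-of v with locate v
  ... | at-s₁        = zero , inj₂ refl
  ... | at-s₂        = suc zero , inj₂ refl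
  ... | at-s₃        = suc (suc zero) , refl
  ... | in-A v∈A     = zero , inj₁ v∈A
  ... | in-A' v∈A'   = suc zero , inj₁ v∈A'

  Class-clique : ∀ t {x y} → Class t x → Class t y → x ≢ y → E G x y
  Class-clique zero             (inj₁ x∈A)  (inj₁ y∈A)  x≢y = A-clique _ _ x∈A y∈A x≢y
  Class-clique zero             (inj₁ x∈A)  (inj₂ refl) _   = Graph.sym G (s₁∼A x∈A)
  Class-clique zero             (inj₂ refl) (inj₁ y∈A)  _   = s₁∼A y∈A
  Class-clique zero             (inj₂ refl) (inj₂ refl) x≢y = contradiction refl x≢y
  Class-clique (suc zero)       (inj₁ x∈A') (inj₁ y∈A') x≢y = A'-clique _ _ x∈A' y∈A' x≢y
  Class-clique (suc zero)       (inj₁ x∈A') (inj₂ refl) _   = Graph.sym G (s₂∼A' x∈A')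
  Class-clique (suc zero)       (inj₂ refl) (inj₁ y∈A') _   = s₂∼A' y∈A'
  Class-clique (suc zero)       (inj₂ refl) (inj₂ refl) x≢y = contradiction refl x≢y
  Class-clique (suc (suc zero)) refl        refl        x≢y = contradiction refl x≢y

  independent-triple-meets-every-class : ∀ {Q : Fin n → Set} {x y z} → Q x → Q y → Q z →
    x ≢ y → x ≢ z → y ≢ z → ¬ E G x y → ¬ E G x z → ¬ E G y z → ∀ t → ∃[ w ] Q w × Class t w
  independent-triple-meets-every-class {x = x} {y} {z} Qx Qy Qz x≢y x≢z y≢z x≁y x≁z y≁z t
    with distinct-triple-covers-Fin3 t (proj₁ (class-of x)) (proj₁ (class-of y)) (proj₁ (class-of z))
           (classes-differ x≢y x≁y) (classes-differ x≢z x≁z) (classes-differ y≢z y≁z)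
    where
    classes-differ : ∀ {u v} → u ≢ v → ¬ E G u v → proj₁ (class-of u) ≢ proj₁ (class-of v)
    classes-differ {u} {v} u≢v u≁v same =
      u≁v (Class-clique _ (proj₂ (class-of u)) (subst (λ t → Class t v) (sym same) (proj₂ (class-of v))) u≢v)
  ... | inj₁ refl        = x , Qx , proj₂ (class-of x)
  ... | inj₂ (inj₁ refl) = y , Qy , proj₂ (class-of y)
  ... | inj₂ (inj₂ refl) = z , Qz , proj₂ (class-of z)

  cross-edge : ∀ {x y} → Class zero x → Class (suc zero) y → E G x y → (x ≡ s₁ × y ≡ a') ⊎ (x ≡ a × y ≡ s₂)
  cross-edge (inj₁ x∈A)  (inj₁ y∈A') e =
    contradiction y∈A' (A-disjoint-A' (component-closed A-comp _ _ x∈A (A'-outside y∈A') e))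
  cross-edge (inj₁ x∈A)  (inj₂ refl) e with to (N[s₂] _) (Graph.sym G e)
  ... | inj₁ x∈A' = contradiction x∈A' (A-disjoint-A' x∈A)
  ... | inj₂ x≡a  = inj₂ (x≡a , refl)
  cross-edge (inj₂ refl) (inj₁ y∈A') e with to (N[s₁] _) e
  ... | inj₁ y∈A  = contradiction y∈A' (A-disjoint-A' y∈A)
  ... | inj₂ y≡a' = inj₁ (refl , y≡a')
  cross-edge (inj₂ refl) (inj₂ refl) e = contradiction e s₁≁s₂

  no-vertex-sees-every-class : ∀ {c} → (∃[ w ] E G c w × Class (suc (suc zero)) w) →
    (∃[ u ] E G c u × Class zero u) → (∃[ v ] E G c v × Class (suc zero) v) → ⊥
  no-vertex-sees-every-class {c} (_ , c∼s₃ , refl) (u , c∼u , u∈K₀) (v , c∼v , v∈K₁)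
    with to (N[s₃] c) (Graph.sym G c∼s₃)
  ... | inj₁ c∈A , c≢a , _ with cross-edge (inj₁ c∈A) v∈K₁ c∼v
  ...   | inj₁ (c≡s₁ , _) = proj₁ (A-outside c∈A) c≡s₁
  ...   | inj₂ (c≡a , _)  = c≢a c≡a
  no-vertex-sees-every-class {c} (_ , c∼s₃ , refl) (u , c∼u , u∈K₀) (v , c∼v , v∈K₁)
      | inj₂ c∈A' , _ , c≢a' with cross-edge u∈K₀ (inj₁ c∈A') (Graph.sym G c∼u)
  ...   | inj₁ (_ , c≡a') = c≢a' c≡a'
  ...   | inj₂ (_ , c≡s₂) = proj₁ (proj₂ (A'-outside c∈A')) c≡s₂

  claw-free : ClawFree G
  claw-free c x y z c∼x c∼y c∼z x≢y x≢z y≢z (x≁y , x≁z , y≁z) =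
    no-vertex-sees-every-class (meets (suc (suc zero))) (meets zero) (meets (suc zero))
    where
    meets : ∀ t → ∃[ w ] E G c w × Class t w
    meets = independent-triple-meets-every-class c∼x c∼y c∼z x≢y x≢z y≢z x≁y x≁z y≁z

  independent⊆triple : ∀ {I} → Independent G I → ∀ {x y z} → x ∈ I → y ∈ I → z ∈ I →
    x ≢ y → x ≢ z → y ≢ z → ∀ {w} → w ∈ I → w ∈ triple x y z
  independent⊆triple {I} independent {x} {y} {z} x∈I y∈I z∈I x≢y x≢z y≢z {w} w∈I with w ∈? triple x y z
  ... | yes w∈xyz = w∈xyz
  ... | no w∉xyz  = clash (meets (proj₁ (class-of w)))
    where
    w≢xyz : w ≢ x × w ≢ y × w ≢ z
    w≢xyz = ∉-triple⁻ w∉xyz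
    meets : ∀ t → ∃[ v ] (v ∈ I × w ≢ v) × Class t v
    meets = independent-triple-meets-every-class
              (x∈I , proj₁ w≢xyz) (y∈I , proj₁ (proj₂ w≢xyz)) (z∈I , proj₂ (proj₂ w≢xyz)) x≢y x≢z y≢z
              (independent x y x∈I y∈I) (independent x z x∈I z∈I) (independent y z y∈I z∈I)
    clash : (∃[ v ] (v ∈ I × w ≢ v) × Class (proj₁ (class-of w)) v) → w ∈ triple x y z
    clash (v , (v∈I , w≢v) , v∈K) =
      contradiction (Class-clique _ (proj₂ (class-of w)) v∈K w≢v) (independent w v w∈I v∈I)

  independent⇒∣I∣≤3 : ∀ I → Independent G I → ∣ I ∣ ≤ 3
  independent⇒∣I∣≤3 I independent = [ bound ∘ 3≤∣p∣⇒three-distinct , id ]′ (≤-total 3 ∣ I ∣)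
    where
    bound : (∃[ x ] ∃[ y ] ∃[ z ] x ∈ I × y ∈ I × z ∈ I × x ≢ y × x ≢ z × y ≢ z) → ∣ I ∣ ≤ 3
    bound (x , y , z , x∈I , y∈I , z∈I , x≢y , x≢z , y≢z) =
      subst (∣ I ∣ ≤_) (∣triple∣≡3 x≢y x≢z y≢z) (p⊆q⇒∣p∣≤∣q∣ (independent⊆triple independent x∈I y∈I z∈I x≢y x≢z y≢z))

  α≡3 : IndependenceNumber G 3
  α≡3 = (S , S-independent , ∣S∣≡3) , independent⇒∣I∣≤3

  n-odd : Odd n
  n-odd = subst Odd (sym n≡∣A∣+∣A'∣+3) (odd+odd+odd ∣A∣-odd ∣A'∣-odd (1 , refl))

  -- Inner vertices of the A–A' paths through s₁ and through s₂.
  Bridge₁ : Fin n → Set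
  Bridge₁ v = v ≡ s₁ ⊎ v ≡ a'

  Bridge₂ : Fin n → Set
  Bridge₂ v = v ≡ a ⊎ v ≡ s₂

  bridges-disjoint : ∀ {e₁ e₂} → Bridge₁ e₁ → Bridge₂ e₂ → e₁ ≢ e₂
  bridges-disjoint (inj₁ refl) (inj₁ refl) = proj₁ (A-outside a∈A) ∘ sym
  bridges-disjoint (inj₁ refl) (inj₂ refl) = s₁≢s₂
  bridges-disjoint (inj₂ refl) (inj₁ refl) = A-A'-distinct a∈A a'∈A' ∘ sym
  bridges-disjoint (inj₂ refl) (inj₂ refl) = proj₁ (proj₂ (A'-outside a'∈A'))

  A∌Bridge₁ : ∀ {x} → x ∈ A → ¬ Bridge₁ x
  A∌Bridge₁ x∈A = [ proj₁ (A-outside x∈A) , A-A'-distinct x∈A a'∈A' ]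

  A'∌Bridge₂ : ∀ {x} → x ∈ A' → ¬ Bridge₂ x
  A'∌Bridge₂ x∈A' = [ A-A'-distinct a∈A x∈A' ∘ sym , proj₁ (proj₂ (A'-outside x∈A')) ]

  module AfterDeleting (X : Subset n) (∣X∣<3 : ∣ X ∣ < 3) where

    _⇝_ : Fin n → Fin n → Set
    u ⇝ v = Walk G (_∉ X) u v

    survivor : ∀ {B : Subset n} → 3 ≤ ∣ B ∣ → ∃[ x ] x ∈ B × x ∉ X
    survivor 3≤∣B∣ = ∣q∣<∣p∣⇒∃∈p∖q (<-≤-trans ∣X∣<3 3≤∣B∣)

    Hub : Fin n → Set
    Hub h = (h ∈ A ⊎ h ∈ A') × h ∉ X

    reaches-hub : ∀ {u} → Location u → u ∉ X → ∃[ h ] Hub h × u ⇝ h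
    reaches-hub at-s₁ s₁∉X with x , x∈A , x∉X ← survivor 3≤∣A∣ =
      x , (inj₁ x∈A , x∉X) , edgeʷ s₁∉X x∉X (s₁∼A x∈A)
    reaches-hub at-s₂ s₂∉X with y , y∈A' , y∉X ← survivor 3≤∣A'∣ =
      y , (inj₂ y∈A' , y∉X) , edgeʷ s₂∉X y∉X (s₂∼A' y∈A')
    reaches-hub at-s₃ s₃∉X
      with b , b' , b∈A , b'∈A , b≢b' , b≢a , b'≢a ← two-others 3≤∣A∣ a
      with c , _ , c∈A' , _ , _ , c≢a' , _ ← two-others 3≤∣A'∣ a'
      with b ∈? X | b' ∈? X
    ... | no b∉X  | _         = b , (inj₁ b∈A , b∉X) , edgeʷ s₃∉X b∉X (s₃∼A∖a b∈A b≢a)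
    ... | yes _   | no b'∉X   = b' , (inj₁ b'∈A , b'∉X) , edgeʷ s₃∉X b'∉X (s₃∼A∖a b'∈A b'≢a)
    ... | yes b∈X | yes b'∈X  = c , (inj₂ c∈A' , c∉X) , edgeʷ s₃∉X c∉X (s₃∼A'∖a' c∈A' c≢a')
      where
      c∉X : c ∉ X
      c∉X = ∣p∣<3⇒third∉p ∣X∣<3 b∈X b'∈X b≢b' (A-A'-distinct b∈A c∈A' ∘ sym) (A-A'-distinct b'∈A c∈A' ∘ sym)
    reaches-hub (in-A u∈A)   u∉X = _ , (inj₁ u∈A , u∉X) , here u∉X
    reaches-hub (in-A' u∈A') u∉X = _ , (inj₂ u∈A' , u∉X) , here u∉X

    Link : Set
    Link = ∃[ l ] ∃[ l' ] l ∈ A × l' ∈ A' × l ∉ X × l' ∉ X × l ⇝ l'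

    link-via-s₃ : ∀ {e₁ e₂} → Bridge₁ e₁ → Bridge₂ e₂ → e₁ ∈ X → e₂ ∈ X → Link
    link-via-s₃ {e₁} {e₂} B₁ B₂ e₁∈X e₂∈X
      with b , _ , b∈A , _ , _ , b≢a , _ ← two-others 3≤∣A∣ a
      with c , _ , c∈A' , _ , _ , c≢a' , _ ← two-others 3≤∣A'∣ a'
      = b , c , b∈A , c∈A' , b∉X , c∉X ,
        step b∉X (Graph.sym G (s₃∼A∖a b∈A b≢a)) (edgeʷ s₃∉X c∉X (s₃∼A'∖a' c∈A' c≢a'))
      where
      survives : ∀ {v} → ¬ Bridge₁ v → ¬ Bridge₂ v → v ∉ X
      survives ¬B₁ ¬B₂ =
        ∣p∣<3⇒third∉p ∣X∣<3 e₁∈X e₂∈X (bridges-disjoint B₁ B₂) (λ { refl → ¬B₁ B₁ }) (λ { refl → ¬B₂ B₂ })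
      b∉X : b ∉ X
      b∉X = survives (A∌Bridge₁ b∈A) [ b≢a , proj₁ (proj₂ (A-outside b∈A)) ]
      c∉X : c ∉ X
      c∉X = survives [ proj₁ (A'-outside c∈A') , c≢a' ] (A'∌Bridge₂ c∈A')
      s₃∉X : s₃ ∉ X
      s₃∉X = survives [ s₁≢s₃ ∘ sym , proj₂ (proj₂ (A'-outside a'∈A')) ∘ sym ]
                      [ proj₂ (proj₂ (A-outside a∈A)) ∘ sym , s₂≢s₃ ∘ sym ]

    link-via-s₂ : ∀ {e₁} → Bridge₁ e₁ → e₁ ∈ X → Link
    link-via-s₂ B₁ e₁∈X with a ∈? X | s₂ ∈? X
    ... | yes a∈X | _        = link-via-s₃ B₁ (inj₁ refl) e₁∈X a∈X
    ... | no _    | yes s₂∈X = link-via-s₃ B₁ (inj₂ refl) e₁∈X s₂∈X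
    ... | no a∉X  | no s₂∉X with y , y∈A' , y∉X ← survivor 3≤∣A'∣ =
      a , y , a∈A , y∈A' , a∉X , y∉X , step a∉X (Graph.sym G s₂∼a) (edgeʷ s₂∉X y∉X (s₂∼A' y∈A'))

    link : Link
    link with s₁ ∈? X | a' ∈? X
    ... | yes s₁∈X | _         = link-via-s₂ (inj₁ refl) s₁∈X
    ... | no _     | yes a'∈X  = link-via-s₂ (inj₂ refl) a'∈X
    ... | no s₁∉X  | no a'∉X with x , x∈A , x∉X ← survivor 3≤∣A∣ =
      x , a' , x∈A , a'∈A' , x∉X , a'∉X , step x∉X (Graph.sym G (s₁∼A x∈A)) (edgeʷ s₁∉X a'∉X s₁∼a')

    hubs-linked : ∀ {h h'} → Hub h → Hub h' → h ⇝ h'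
    hubs-linked (inj₁ h∈A , h∉X)   (inj₁ h'∈A , h'∉X)   = clique-walk A-clique h∈A h'∈A h∉X h'∉X
    hubs-linked (inj₂ h∈A' , h∉X)  (inj₂ h'∈A' , h'∉X)  = clique-walk A'-clique h∈A' h'∈A' h∉X h'∉X
    hubs-linked (inj₁ h∈A , h∉X)   (inj₂ h'∈A' , h'∉X)
      with l , l' , l∈A , l'∈A' , l∉X , l'∉X , l⇝l' ← link =
      clique-walk A-clique h∈A l∈A h∉X l∉X ++ʷ (l⇝l' ++ʷ clique-walk A'-clique l'∈A' h'∈A' l'∉X h'∉X)
    hubs-linked (inj₂ h∈A' , h∉X)  (inj₁ h'∈A , h'∉X)   = reverseʷ (hubs-linked (inj₁ h'∈A , h'∉X) (inj₂ h∈A' , h∉X))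

    connected-without : ConnectedWithout G X
    connected-without u v u∉X v∉X
      with h , hub , u⇝h ← reaches-hub (locate u) u∉X
      with h' , hub' , v⇝h' ← reaches-hub (locate v) v∉X
      = u⇝h ++ʷ (hubs-linked hub hub' ++ʷ reverseʷ v⇝h')

  connected : Connected G
  connected u v = mapʷ (λ _ → tt) (AfterDeleting.connected-without ∅ (subst (_< 3) (sym (∣⊥∣≡0 n)) (s≤s z≤n)) u v ∉⊥ ∉⊥)

  S-separates-A-from-A' : ¬ KConnected G 4
  S-separates-A-from-A' (_ , 4-connected) =
    A-disjoint-A' (walk-stays-in A (component-closed A-comp) (mapʷ ∉S⇒outside a⇝a') a∈A) a'∈A'
    where
    a⇝a' : Walk G (_∉ S) a a'
    a⇝a' = 4-connected S (subst (_< 4) (sym ∣S∣≡3) (n<1+n 3)) a a'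
             (outside⇒∉S (A-outside a∈A)) (outside⇒∉S (A'-outside a'∈A'))

  κ≡3 : VertexConnectivity G 3
  κ≡3 = (3<n , AfterDeleting.connected-without) , S-separates-A-from-A'
    where
    3<n : 3 < n
    3<n = subst (3 <_) (sym n≡∣A∣+∣A'∣+3) (+-mono-≤ 3≤∣A∣ (≤-trans (s≤s z≤n) (m≤n+m 3 ∣ A' ∣)))

  cross-edge-hits : ∀ {u v x y} → u ≡ s₁ ⊎ u ≡ a → v ≡ s₂ ⊎ v ≡ a' → ¬ E G u v →
    Class zero x → Class (suc zero) y → E G x y → x ≡ u ⊎ y ≡ v
  cross-edge-hits u∈s₁a v∈s₂a' u≁v x∈K₀ y∈K₁ e with cross-edge x∈K₀ y∈K₁ e | u∈s₁a | v∈s₂a'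
  ... | inj₁ (refl , refl) | inj₁ refl | _         = inj₁ refl
  ... | inj₁ (refl , refl) | inj₂ refl | inj₁ refl = contradiction (Graph.sym G s₂∼a) u≁v
  ... | inj₁ (refl , refl) | inj₂ refl | inj₂ refl = inj₂ refl
  ... | inj₂ (refl , refl) | inj₂ refl | _         = inj₁ refl
  ... | inj₂ (refl , refl) | inj₁ refl | inj₁ refl = inj₂ refl
  ... | inj₂ (refl , refl) | inj₁ refl | inj₂ refl = contradiction s₁∼a' u≁v

  K₀ : Subset n
  K₀ = ⁅ s₁ ⁆ ∪ A

  Class₀⇒∈K₀ : ∀ {v} → Class zero v → v ∈ K₀
  Class₀⇒∈K₀ (inj₁ v∈A)  = x∈p∪q⁺ (inj₂ v∈A)
  Class₀⇒∈K₀ (inj₂ refl) = x∈p∪q⁺ (inj₁ (x∈⁅x⁆ s₁))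

  ∈K₀⇒Class₀ : ∀ {v} → v ∈ K₀ → Class zero v
  ∈K₀⇒Class₀ v∈K₀ = [ inj₂ ∘ x∈⁅y⁆⇒x≡y s₁ , inj₁ ] (x∈p∪q⁻ ⁅ s₁ ⁆ A v∈K₀)

  ∣K₀∣≡1+∣A∣ : ∣ K₀ ∣ ≡ suc ∣ A ∣
  ∣K₀∣≡1+∣A∣ = ∣⁅x⁆∪p∣≡1+∣p∣ (λ s₁∈A → proj₁ (A-outside s₁∈A) refl)

  module _ {M} (M-maximal : IsMaximalMatching G M) where

    Uncovered : Fin n → Set
    Uncovered v = v ∉ₗ endpoints G M

    uncovered-Class₀⇒s₁-or-a : ∀ {u} → Uncovered s₃ → Uncovered u → Class zero u → u ≡ s₁ ⊎ u ≡ a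
    uncovered-Class₀⇒s₁-or-a _ _ (inj₂ u≡s₁) = inj₁ u≡s₁
    uncovered-Class₀⇒s₁-or-a {u} s₃-unc u-unc (inj₁ u∈A) with u ≟ a
    ... | yes u≡a = inj₂ u≡a
    ... | no u≢a  = contradiction (s₃∼A∖a u∈A u≢a) (maximal⇒uncovered-nonadjacent G M-maximal s₃-unc u-unc)

    uncovered-Class₁⇒s₂-or-a' : ∀ {v} → Uncovered s₃ → Uncovered v → Class (suc zero) v → v ≡ s₂ ⊎ v ≡ a'
    uncovered-Class₁⇒s₂-or-a' _ _ (inj₂ v≡s₂) = inj₁ v≡s₂
    uncovered-Class₁⇒s₂-or-a' {v} s₃-unc v-unc (inj₁ v∈A') with v ≟ a'
    ... | yes v≡a' = inj₂ v≡a'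
    ... | no v≢a'  = contradiction (s₃∼A'∖a' v∈A' v≢a') (maximal⇒uncovered-nonadjacent G M-maximal s₃-unc v-unc)

    K₀-closed : ∀ {u v} → Uncovered s₃ → Uncovered u → Uncovered v → Class zero u → Class (suc zero) v →
      ClosedAmongCovered G K₀ M
    K₀-closed {u} {v} s₃-unc u-unc v-unc u∈K₀ v∈K₁ {x} {y} x-cov y-cov e x∈K₀ with class-of y
    ... | zero , y∈K₀              = Class₀⇒∈K₀ y∈K₀
    ... | suc (suc zero) , refl    = contradiction y-cov s₃-unc
    ... | suc zero , y∈K₁
      with cross-edge-hits (uncovered-Class₀⇒s₁-or-a s₃-unc u-unc u∈K₀) (uncovered-Class₁⇒s₂-or-a' s₃-unc v-unc v∈K₁)
             (maximal⇒uncovered-nonadjacent G M-maximal u-unc v-unc) (∈K₀⇒Class₀ x∈K₀) y∈K₁ e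
    ...   | inj₁ refl = contradiction x-cov u-unc
    ...   | inj₂ refl = contradiction y-cov v-unc

    ∣coveredIn-K₀∣≡∣A∣ : ∀ {u} → Uncovered u → Class zero u → ∣ coveredIn G K₀ M ∣ ≡ ∣ A ∣
    ∣coveredIn-K₀∣≡∣A∣ {u} u-unc u∈K₀ = suc-injective (begin
      suc ∣ coveredIn G K₀ M ∣        ≡⟨ sym (∣⁅x⁆∪p∣≡1+∣p∣ (u-unc ∘ proj₂ ∘ ∈-coveredIn⁻ G K₀ M)) ⟩
      ∣ ⁅ u ⁆ ∪ coveredIn G K₀ M ∣    ≡⟨ cong ∣_∣ (sym K₀≡u∪covered) ⟩
      ∣ K₀ ∣                          ≡⟨ ∣K₀∣≡1+∣A∣ ⟩
      suc ∣ A ∣                       ∎)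
      where
      open ≡-Reasoning
      covered-unless-u : ∀ {w} → w ∈ K₀ → w ∈ ⁅ u ⁆ ∪ coveredIn G K₀ M
      covered-unless-u {w} w∈K₀ with w ≟ u
      ... | yes refl = x∈p∪q⁺ (inj₁ (x∈⁅x⁆ w))
      ... | no w≢u   = x∈p∪q⁺ (inj₂ (∈-coveredIn⁺ G K₀ M w∈K₀
                         (maximal⇒covered G M-maximal u-unc (Class-clique zero (∈K₀⇒Class₀ w∈K₀) u∈K₀ w≢u))))
      K₀≡u∪covered : K₀ ≡ ⁅ u ⁆ ∪ coveredIn G K₀ M
      K₀≡u∪covered = ⊆-antisym covered-unless-u
        (λ w∈ → [ (λ w∈u → subst (_∈ K₀) (sym (x∈⁅y⁆⇒x≡y u w∈u)) (Class₀⇒∈K₀ u∈K₀)) , proj₁ ∘ ∈-coveredIn⁻ G K₀ M ]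
                (x∈p∪q⁻ ⁅ u ⁆ _ w∈))

    uncovered-in-every-class⇒⊥ : (∃[ w ] Uncovered w × Class (suc (suc zero)) w) →
      (∃[ u ] Uncovered u × Class zero u) → (∃[ v ] Uncovered v × Class (suc zero) v) → ⊥
    uncovered-in-every-class⇒⊥ (_ , s₃-unc , refl) (u , u-unc , u∈K₀) (v , v-unc , v∈K₁) =
      even⇒¬odd (subst Even (∣coveredIn-K₀∣≡∣A∣ u-unc u∈K₀)
                  (even-coveredIn G K₀ M (proj₁ M-maximal) (K₀-closed s₃-unc u-unc v-unc u∈K₀ v∈K₁)))
                ∣A∣-odd

    no-three-uncovered : ∀ {x y z} → Uncovered x → Uncovered y → Uncovered z → x ≢ y → x ≢ z → y ≢ z → ⊥
    no-three-uncovered x-unc y-unc z-unc x≢y x≢z y≢z =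
      uncovered-in-every-class⇒⊥ (meets (suc (suc zero))) (meets zero) (meets (suc zero))
      where
      nonadjacent : ∀ {x y} → Uncovered x → Uncovered y → ¬ E G x y
      nonadjacent = maximal⇒uncovered-nonadjacent G M-maximal
      meets : ∀ t → ∃[ w ] Uncovered w × Class t w
      meets = independent-triple-meets-every-class x-unc y-unc z-unc x≢y x≢z y≢z
                (nonadjacent x-unc y-unc) (nonadjacent x-unc z-unc) (nonadjacent y-unc z-unc)

    U : Subset n
    U = ∁ (fromList (endpoints G M))

    ∈U⇒uncovered : ∀ {v} → v ∈ U → Uncovered v
    ∈U⇒uncovered v∈U v-cov = x∈∁p⇒x∉p v∈U (∈-fromDec⁺ _ v-cov)

    ∣U∣<3 : ∣ U ∣ < 3
    ∣U∣<3 = ≰⇒> (no-triple ∘ 3≤∣p∣⇒three-distinct)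
      where
      no-triple : ¬ (∃[ x ] ∃[ y ] ∃[ z ] x ∈ U × y ∈ U × z ∈ U × x ≢ y × x ≢ z × y ≢ z)
      no-triple (_ , _ , _ , x∈U , y∈U , z∈U , x≢y , x≢z , y≢z) =
        no-three-uncovered (∈U⇒uncovered x∈U) (∈U⇒uncovered y∈U) (∈U⇒uncovered z∈U) x≢y x≢z y≢z

    n≡2∣M∣+∣U∣ : n ≡ 2 * length M + ∣ U ∣
    n≡2∣M∣+∣U∣ = begin
      n                                       ≡⟨ sym (m+[n∸m]≡n (∣p∣≤n covered)) ⟩
      ∣ covered ∣ + (n ∸ ∣ covered ∣)         ≡⟨ cong₂ _+_ ∣covered∣≡2∣M∣ (sym (∣∁p∣≡n∸∣p∣ covered)) ⟩
      2 * length M + ∣ U ∣                    ∎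
      where
      open ≡-Reasoning
      covered : Subset n
      covered = fromList (endpoints G M)
      ∣covered∣≡2∣M∣ : ∣ covered ∣ ≡ 2 * length M
      ∣covered∣≡2∣M∣ = trans (∣fromList∣≡length (proj₂ (proj₁ M-maximal))) (length-endpoints G M)

    1+2∣M∣≡n : suc (2 * length M) ≡ n
    1+2∣M∣≡n = begin
      suc (2 * length M)     ≡⟨ +-comm 1 (2 * length M) ⟩
      2 * length M + 1       ≡⟨ cong (2 * length M +_) (sym (odd[2m+u]⇒u≡1 (length M) ∣U∣<3 (subst Odd n≡2∣M∣+∣U∣ n-odd))) ⟩
      2 * length M + ∣ U ∣   ≡⟨ sym n≡2∣M∣+∣U∣ ⟩
      n                      ∎
      where open ≡-Reasoning

  equimatchable : Equimatchable G
  equimatchable M M' M-maximal M'-maximal =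
    *-cancelˡ-≡ _ _ 2 (suc-injective (trans (1+2∣M∣≡n M-maximal) (sym (1+2∣M∣≡n M'-maximal))))

proposition2 : ∀ {n : ℕ} (G : Graph n) (s₁ s₂ s₃ : Fin n) (A A' : Subset n) (a a' : Fin n) →
    s₁ ≢ s₂ → s₁ ≢ s₃ → s₂ ≢ s₃ →
    ¬ E G s₁ s₂ → ¬ E G s₁ s₃ → ¬ E G s₂ s₃ →
    IsComponent G (λ v → v ≢ s₁ × v ≢ s₂ × v ≢ s₃) A →
    IsComponent G (λ v → v ≢ s₁ × v ≢ s₂ × v ≢ s₃) A' →
    A ≢ A' →
    (∀ C → IsComponent G (λ v → v ≢ s₁ × v ≢ s₂ × v ≢ s₃) C → C ≡ A ⊎ C ≡ A') →
    (∀ u v → u ∈ A → v ∈ A → u ≢ v → E G u v) → 3 ≤ ∣ A ∣ → Odd ∣ A ∣ →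
    (∀ u v → u ∈ A' → v ∈ A' → u ≢ v → E G u v) → 3 ≤ ∣ A' ∣ → Odd ∣ A' ∣ →
    a ∈ A → a' ∈ A' →
    (∀ v → E G s₁ v ⇔ (v ∈ A ⊎ v ≡ a')) →
    (∀ v → E G s₂ v ⇔ (v ∈ A' ⊎ v ≡ a)) →
    (∀ v → E G s₃ v ⇔ ((v ∈ A ⊎ v ∈ A') × v ≢ a × v ≢ a')) →
    Connected G × Equimatchable G × ClawFree G × Odd n
      × IndependenceNumber G 3 × VertexConnectivity G 3
proposition2 G s₁ s₂ s₃ A A' a a' s₁≢s₂ s₁≢s₃ s₂≢s₃ s₁≁s₂ s₁≁s₃ s₂≁s₃ A-comp A'-comp A≢A' only-components
  A-clique 3≤∣A∣ ∣A∣-odd A'-clique 3≤∣A'∣ ∣A'∣-odd a∈A a'∈A' N[s₁] N[s₂] N[s₃] =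
  connected , equimatchable , claw-free , n-odd , α≡3 , κ≡3
  where
  open Proposition2Graph G s₁ s₂ s₃ A A' a a' s₁≢s₂ s₁≢s₃ s₂≢s₃ s₁≁s₂ s₁≁s₃ s₂≁s₃ A-comp A'-comp A≢A' only-components
    A-clique 3≤∣A∣ ∣A∣-odd A'-clique 3≤∣A'∣ ∣A'∣-odd a∈A a'∈A' N[s₁] N[s₂] N[s₃]
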